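{- Let $n\ge 2$ be an integer. Construct the graph $G=(V,E)$ with weights $c=(c_1,c_2)\colon E\to\mathbb{Z}\times\mathbb{N}_+$ as follows: for each $i\in[n]$ create vertices $v_i,v_i',w_i$ and edges $\{v_i,w_i\}$ with weight $(2^i,2^i)^\mathsf{T}$, $\{v_i,v_i'\}$ with weight $(0,2^i)^\mathsf{T}$ and $\{v_i',w_i\}$ with weight $(0,2^i)^\mathsf{T}$; for each $i\in[n-1]$ add the edge $\{w_i,v_{i+1}\}$ with weight $(0,1)^\mathsf{T}$; set $s:=v_1$, $t:=w_n$ and add the edge $\{s,t\}$ with weight $(2^{n+1},1)^\mathsf{T}$. Let $X$ be the set of all spanners $S$ of $G$ that contain every edge $e\in E$ with $c_1(e)=0$ and do not contain $\{s,t\}$. Then for every $S\in X$, \[f_2(S)=\max_{u,v\in V,\,u\neq v}\frac{d^S_{c_2}(u,v)}{d^E_{c_2}(u,v)}=\frac{d^S_{c_2}(s,t)}{d^E_{c_2}(s,t)}.\]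
   Context: $[n]=\{1,\dots,n\}$. A spanner of a connected undirected graph $G=(V,E)$ is a set $S\subseteq E$ such that $(V,S)$ is connected. For $F\subseteq E$, $d^F_{c_2}(u,v)$ is the length of a shortest $u$-$v$-path in $(V,F)$ with respect to edge lengths $c_2$, and $f_2(S)=\max_{u\neq v}d^S_{c_2}(u,v)/d^E_{c_2}(u,v)$. -}

module Defs where

open import Data.Nat using (ℕ; zero; suc; _+_; _^_; NonZero)
open import Data.Integer using (ℤ; +_)
open import Data.Rational using (ℚ; _/_; _≤_)
open import Data.Fin using (Fin; zero; suc; toℕ; inject₁; fromℕ)
open import Data.Bool using (Bool; true; false)
open import Data.Product using (Σ; _×_; _,_; ∃)
open import Data.Sum using (_⊎_)
open import Relation.Binary.PropositionalEquality using (_≡_; _≢_)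

-- The graph G for parameter n.  Index i : Fin n stands for i+1 ∈ [n].
data Kind : Set where
  kv kv' kw : Kind

-- vertex (kv , i) = v_{i+1}, (kv' , i) = v'_{i+1}, (kw , i) = w_{i+1}
Vert : ℕ → Set
Vert n = Kind × Fin n

data Edge : ℕ → Set where
  vw  : ∀ {n} → Fin n → Edge n
  vv' : ∀ {n} → Fin n → Edge n
  v'w : ∀ {n} → Fin n → Edge n
  wv  : ∀ {m} → Fin m → Edge (suc m)
  st  : ∀ {m} → Edge (suc m)

s : ∀ {m} → Vert (suc m)
s = (kv , zero)

t : ∀ {m} → Vert (suc m)
t {m} = (kw , fromℕ m)

ends : ∀ {n} → Edge n → Vert n × Vert n
ends (vw i)  = (kv , i) , (kw , i)
ends (vv' i) = (kv , i) , (kv' , i)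
ends (v'w i) = (kv' , i) , (kw , i)
ends (wv i)  = (kw , inject₁ i) , (kv , suc i)
ends (st {m}) = s {m} , t {m}

-- weights c = (c1 , c2) : E → ℤ × ℕ₊ ; 2^i with i = toℕ k + 1
c₁ : ∀ {n} → Edge n → ℤ
c₁ (vw i)   = + (2 ^ (toℕ i + 1))
c₁ (vv' i)  = + 0
c₁ (v'w i)  = + 0
c₁ (wv i)   = + 0
c₁ (st {m}) = + (2 ^ (suc m + 1))

c₂ : ∀ {n} → Edge n → ℕ
c₂ (vw i)  = 2 ^ (toℕ i + 1)
c₂ (vv' i) = 2 ^ (toℕ i + 1)
c₂ (v'w i) = 2 ^ (toℕ i + 1)
c₂ (wv i)  = 1
c₂ st      = 1

EdgeSet : ℕ → Set
EdgeSet n = Edge n → Bool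

allE : ∀ {n} → EdgeSet n
allE _ = true

Joins : ∀ {n} → Edge n → Vert n → Vert n → Set
Joins e u w = (ends e ≡ (u , w)) ⊎ (ends e ≡ (w , u))

data Walk {n} (F : EdgeSet n) : Vert n → Vert n → Set where
  [] : ∀ {u} → Walk F u u
  step : ∀ {u w v} (e : Edge n) → F e ≡ true → Joins e u w →
         Walk F w v → Walk F u v

len : ∀ {n} {F : EdgeSet n} {u v} → Walk F u v → ℕ
len [] = 0
len (step e _ _ p) = c₂ e + len p

IsDist : ∀ {n} → EdgeSet n → Vert n → Vert n → ℕ → Set
IsDist F u v d =
  Σ (Walk F u v) (λ p → len p ≡ d) × (∀ (p : Walk F u v) → d Data.Nat.≤ len p)

Connected : ∀ {n} → EdgeSet n → Set
Connected S = ∀ u v → Walk S u v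

Spanner : ∀ {n} → EdgeSet n → Set
Spanner S = Connected S

InX : ∀ {m} → EdgeSet (suc m) → Set
InX S = Spanner S × (∀ e → c₁ e ≡ + 0 → S e ≡ true) × (S st ≡ false)

Stretch : ∀ {n} → EdgeSet n → Vert n → Vert n → ℚ → Set
Stretch S u v q =
  Σ ℕ λ a → Σ ℕ λ b → IsDist S u v a × IsDist allE u v b ×
    Σ (NonZero b) λ nz → q ≡ _/_ (+ a) b {{nz}}

IsF₂ : ∀ {n} → EdgeSet n → ℚ → Set
IsF₂ S q =
  (Σ _ λ u → Σ _ λ v → u ≢ v × Stretch S u v q) ×
  (∀ u v q' → u ≢ v → Stretch S u v q' → q' ≤ q)

-- Give the vertices of gadget i a potential: φ v_i = pos i, the S-distance from s to v_i,
-- φ v_i' = pos i + 2^i and φ w_i = pos i + cost i, where cost i is 2^i if S keeps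
-- {v_i,w_i} and 2^(i+1) otherwise.  As {s,t} ∉ S, no edge of S raises φ by more than its
-- length, so d^S(s,t) ≥ φ t = Φ.  As S keeps every edge with c₁ = 0, any two vertices are
-- joined in S by a walk through the gadgets between them of length at most Φ.  Since
-- d^E(s,t) = 1 and every d^E(u,v) ≥ 1, each stretch is at most d^S(u,v) ≤ Φ ≤ d^S(s,t).
module Submission where

open import Defs
open import Data.Nat using (ℕ; suc; _≤_)
open import Data.Rational using (ℚ)
open import Data.Nat using (zero; _+_; z≤n; s≤s; NonZero)
open import Data.Nat.Properties
open import Data.Fin using (Fin; zero; suc; inject₁; fromℕ)
import Data.Fin.Base as Fin using (_≤_)
import Data.Fin.Properties as Fin using (≤-total)
open import Data.Fin.Induction using (<-weakInduction-startingFrom; >-weakInduction)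
open import Data.Bool using (Bool; true; false)
open import Data.Product using (Σ; _,_)
open import Data.Sum using (inj₁; inj₂)
import Data.Integer as ℤ
import Data.Integer.Properties as ℤ
import Data.Rational as ℚ
import Data.Rational.Properties as ℚ
import Data.Rational.Unnormalised as ℚᵘ
import Data.Rational.Unnormalised.Properties as ℚᵘ
open import Relation.Binary.PropositionalEquality
open import Data.Nat.Solver using (module +-*-Solver)
open +-*-Solver using (_:+_; con; _:=_)

module _ {n} {F : EdgeSet n} where

  infixr 5 _++_

  _++_ : ∀ {u v w} → Walk F u v → Walk F v w → Walk F u w
  [] ++ q = q
  step e e∈F j p ++ q = step e e∈F j (p ++ q)

  len-++ : ∀ {u v w} (p : Walk F u v) (q : Walk F v w) → len (p ++ q) ≡ len p + len q
  len-++ [] q = refl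
  len-++ (step e _ _ p) q = trans (cong (c₂ e +_) (len-++ p q)) (sym (+-assoc (c₂ e) _ _))

  Joins-sym : ∀ {e : Edge n} {u w} → Joins e u w → Joins e w u
  Joins-sym (inj₁ eq) = inj₂ eq
  Joins-sym (inj₂ eq) = inj₁ eq

  reverse : ∀ {u v} → Walk F u v → Walk F v u
  reverse [] = []
  reverse (step e e∈F j p) = reverse p ++ step e e∈F (Joins-sym j) []

  len-reverse : ∀ {u v} (p : Walk F u v) → len (reverse p) ≡ len p
  len-reverse [] = refl
  len-reverse (step e e∈F j p) = begin
    len (reverse p ++ step e e∈F (Joins-sym j) [])  ≡⟨ len-++ (reverse p) _ ⟩
    len (reverse p) + (c₂ e + 0)                    ≡⟨ cong₂ _+_ (len-reverse p) (+-identityʳ (c₂ e)) ⟩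
    len p + c₂ e                                    ≡⟨ +-comm (len p) (c₂ e) ⟩
    c₂ e + len p                                    ∎
    where open ≡-Reasoning

  potential-bound : (φ : Vert n → ℕ) →
                    (∀ e {x y} → F e ≡ true → Joins e x y → φ y ≤ φ x + c₂ e) →
                    ∀ {u v} (p : Walk F u v) → φ v ≤ φ u + len p
  potential-bound φ edge {u} [] = m≤m+n (φ u) 0
  potential-bound φ edge {u} (step e e∈F j p) = begin
    φ _                 ≤⟨ potential-bound φ edge p ⟩
    φ _ + len p         ≤⟨ +-monoˡ-≤ (len p) (edge e e∈F j) ⟩
    φ u + c₂ e + len p  ≡⟨ +-assoc (φ u) (c₂ e) (len p) ⟩
    φ u + len (step e e∈F j p) ∎
    where open ≤-Reasoning

Walk≤ : ∀ {n} → EdgeSet n → Vert n → Vert n → ℕ → Set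
Walk≤ F u v k = Σ (Walk F u v) λ p → len p ≤ k

reverse≤ : ∀ {n} {F : EdgeSet n} {u v k} → Walk≤ F u v k → Walk≤ F v u k
reverse≤ (p , p≤k) = reverse p , subst (_≤ _) (sym (len-reverse p)) p≤k

prefixSum : ∀ {n} → (Fin n → ℕ) → Fin (suc n) → ℕ
prefixSum f zero = 0
prefixSum {suc n} f (suc i) = f zero + prefixSum (λ k → f (suc k)) i

prefixSum-suc : ∀ {n} (f : Fin n → ℕ) (k : Fin n) →
                prefixSum f (suc k) ≡ prefixSum f (inject₁ k) + f k
prefixSum-suc f zero = +-comm (f zero) 0
prefixSum-suc f (suc k) = trans (cong (f zero +_) (prefixSum-suc (λ i → f (suc i)) k))
                                (sym (+-assoc (f zero) _ _))

-- Length of a shortest v_i–w_i walk in a gadget whose three edges have c₂-length w;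
-- the flag says whether {v_i,w_i} is available.
crossing : Bool → ℕ → ℕ
crossing true w = w
crossing false w = w + w

w≤crossing : ∀ b w → w ≤ crossing b w
w≤crossing true w = ≤-refl
w≤crossing false w = m≤m+n w w

crossing≤w+w : ∀ b w → crossing b w ≤ w + w
crossing≤w+w true w = m≤m+n w w
crossing≤w+w false w = ≤-refl

fromℚᵘ-mono-≤ : ∀ {p q} → p ℚᵘ.≤ q → ℚ.fromℚᵘ p ℚ.≤ ℚ.fromℚᵘ q
fromℚᵘ-mono-≤ {p} {q} p≤q = ℚ.toℚᵘ-cancel-≤
  (ℚᵘ.≤-respˡ-≃ (ℚᵘ.≃-sym (ℚ.toℚᵘ-fromℚᵘ p)) (ℚᵘ.≤-respʳ-≃ (ℚᵘ.≃-sym (ℚ.toℚᵘ-fromℚᵘ q)) p≤q))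

/-≤-/1 : ∀ {a′ a} b′ b {{_ : NonZero b′}} {{_ : NonZero b}} → a′ ≤ a → b ≤ 1 →
         ℚ._/_ (ℤ.+ a′) b′ ℚ.≤ ℚ._/_ (ℤ.+ a) b
/-≤-/1 {a′} {a} (suc d) (suc zero) a′≤a _ =
  fromℚᵘ-mono-≤ {ℚᵘ.mkℚᵘ (ℤ.+ a′) d} {ℚᵘ.mkℚᵘ (ℤ.+ a) 0} (ℚᵘ.*≤* (subst₂ ℤ._≤_
  (ℤ.pos-* a′ 1) (ℤ.pos-* a (suc d))
  (ℤ.+≤+ (≤-trans (≤-reflexive (*-identityʳ a′)) (≤-trans a′≤a (m≤m*n a (suc d)))))))
/-≤-/1 _ zero {{_}} {{()}} _ _
/-≤-/1 _ (suc (suc _)) _ (s≤s ())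

module Gadgets {m} (S : EdgeSet (suc m)) where

  cost : Fin (suc m) → ℕ
  cost i = crossing (S (vw i)) (c₂ (vw i))

  pos : Fin (suc m) → ℕ
  pos = prefixSum λ k → cost (inject₁ k) + 1

  exit : Fin (suc m) → ℕ
  exit i = pos i + cost i

  Φ : ℕ
  Φ = exit (fromℕ m)

  pos-suc : ∀ k → pos (suc k) ≡ exit (inject₁ k) + 1
  pos-suc k = trans (prefixSum-suc _ k) (sym (+-assoc (pos (inject₁ k)) _ 1))

  exit≤Φ : ∀ j → exit j ≤ Φ
  exit≤Φ = >-weakInduction (λ j → exit j ≤ Φ) ≤-refl λ k exit[1+k]≤Φ → begin
    exit (inject₁ k)      ≤⟨ m≤m+n _ 1 ⟩
    exit (inject₁ k) + 1  ≡⟨ pos-suc k ⟨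
    pos (suc k)           ≤⟨ m≤m+n _ (cost (suc k)) ⟩
    exit (suc k)          ≤⟨ exit[1+k]≤Φ ⟩
    Φ                     ∎
    where open ≤-Reasoning

  φ : Vert (suc m) → ℕ
  φ (kv , i) = pos i
  φ (kv' , i) = pos i + c₂ (vv' i)
  φ (kw , i) = exit i

  module _ (st∉S : S st ≡ false) where

    φ-edge : ∀ e {x y} → S e ≡ true → Joins e x y → φ y ≤ φ x + c₂ e
    φ-edge (vw i) e∈S (inj₁ refl) rewrite e∈S = ≤-refl
    φ-edge (vw i) e∈S (inj₂ refl) = ≤-trans (m≤m+n _ _) (m≤m+n _ _)
    φ-edge (vv' i) e∈S (inj₁ refl) = ≤-refl
    φ-edge (vv' i) e∈S (inj₂ refl) = ≤-trans (m≤m+n _ _) (m≤m+n _ _)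
    φ-edge (v'w i) e∈S (inj₁ refl) = ≤-trans
      (+-monoʳ-≤ (pos i) (crossing≤w+w (S (vw i)) _)) (≤-reflexive (sym (+-assoc (pos i) _ _)))
    φ-edge (v'w i) e∈S (inj₂ refl) = +-monoˡ-≤ _ (m≤m+n (pos i) (cost i))
    φ-edge (wv k) e∈S (inj₁ refl) = ≤-reflexive (pos-suc k)
    φ-edge (wv k) e∈S (inj₂ refl) = ≤-trans (≤-trans (m≤m+n _ 1) (≤-reflexive (sym (pos-suc k))))
                                            (m≤m+n _ 1)
    φ-edge st e∈S _ with () ← trans (sym e∈S) st∉S

    Φ≤len : (p : Walk S s t) → Φ ≤ len p
    Φ≤len = potential-bound φ φ-edge

  module _ (zero-c₁⊆S : ∀ e → c₁ e ≡ ℤ.+ 0 → S e ≡ true) where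

    across : ∀ i → Walk≤ S (kv , i) (kw , i) (cost i)
    across i with S (vw i) in vw∈S
    ... | true = step (vw i) vw∈S (inj₁ refl) [] , ≤-reflexive (+-identityʳ _)
    ... | false = step (vv' i) (zero-c₁⊆S _ refl) (inj₁ refl)
                    (step (v'w i) (zero-c₁⊆S _ refl) (inj₁ refl) []) ,
                  ≤-reflexive (cong (c₂ (vw i) +_) (+-identityʳ _))

    zero-hop : ∀ i (e : Edge (suc m)) {x y} → c₁ e ≡ ℤ.+ 0 → c₂ e ≡ c₂ (vw i) →
               Joins e x y → Walk≤ S x y (cost i)
    zero-hop i e c₁e≡0 c₂e≡w j =
      step e (zero-c₁⊆S e c₁e≡0) j [] ,
      ≤-trans (≤-reflexive (trans (+-identityʳ _) c₂e≡w)) (w≤crossing (S (vw i)) _)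

    within : ∀ κ₁ κ₂ i → Walk≤ S (κ₁ , i) (κ₂ , i) (cost i)
    within kv kv i = [] , z≤n
    within kv kv' i = zero-hop i (vv' i) refl refl (inj₁ refl)
    within kv kw i = across i
    within kv' kv i = reverse≤ (within kv kv' i)
    within kv' kv' i = [] , z≤n
    within kv' kw i = zero-hop i (v'w i) refl refl (inj₁ refl)
    within kw kv i = reverse≤ (across i)
    within kw kv' i = reverse≤ (within kv' kw i)
    within kw kw i = [] , z≤n

    Spans : Fin (suc m) → Fin (suc m) → Set
    Spans i j = ∀ κ₁ κ₂ → Σ (Walk S (κ₁ , i) (κ₂ , j)) λ p → len p + pos i ≤ exit j

    spans : ∀ {i j} → i Fin.≤ j → Spans i j
    spans {i} = <-weakInduction-startingFrom (Spans i) base next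
      where
      base : Spans i i
      base κ₁ κ₂ with within κ₁ κ₂ i
      ... | p , p≤ = p , ≤-trans (≤-reflexive (+-comm (len p) (pos i))) (+-monoʳ-≤ (pos i) p≤)

      next : ∀ k → Spans i (inject₁ k) → Spans i (suc k)
      next k ih κ₁ κ₂ with ih κ₁ kw | within kv κ₂ (suc k)
      ... | p , p≤ | q , q≤ =
        p ++ step (wv k) (zero-c₁⊆S _ refl) (inj₁ refl) q , (begin
          len (p ++ step (wv k) _ _ q) + pos i  ≡⟨ cong (_+ pos i) (len-++ p _) ⟩
          len p + (1 + len q) + pos i           ≡⟨ solve ⟩
          (len p + pos i) + 1 + len q           ≤⟨ +-mono-≤ (+-monoˡ-≤ 1 p≤) q≤ ⟩
          exit (inject₁ k) + 1 + cost (suc k)   ≡⟨ cong (_+ cost (suc k)) (pos-suc k) ⟨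
          exit (suc k)                          ∎)
        where
        open ≤-Reasoning
        solve : len p + (1 + len q) + pos i ≡ (len p + pos i) + 1 + len q
        solve = +-*-Solver.solve 3 (λ x y z → x :+ (con 1 :+ y) :+ z := (x :+ z) :+ con 1 :+ y)
                  refl (len p) (len q) (pos i)

    spans⇒walk≤Φ : ∀ i j {u v} → Σ (Walk S u v) (λ p → len p + pos i ≤ exit j) → Walk≤ S u v Φ
    spans⇒walk≤Φ i j (p , p≤) = p , ≤-trans (m≤m+n (len p) (pos i)) (≤-trans p≤ (exit≤Φ j))

    walk≤Φ : ∀ u v → Walk≤ S u v Φ
    walk≤Φ (κ₁ , i) (κ₂ , j) with Fin.≤-total i j
    ... | inj₁ i≤j = spans⇒walk≤Φ i j (spans i≤j κ₁ κ₂)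
    ... | inj₂ j≤i = reverse≤ (spans⇒walk≤Φ j i (spans j≤i κ₂ κ₁))

lemma3 : (m : ℕ) → 2 ≤ suc m → (S : EdgeSet (suc m)) → InX S →
    (q : ℚ) → Stretch S s t q → IsF₂ S q
lemma3 m _ S (_ , zero-c₁⊆S , st∉S) q
       st-stretch@(_ , b , ((st-walk , refl) , _) , (_ , b-min) , b≢0 , refl) =
  (s , t , (λ ()) , st-stretch) , stretch≤
  where
  open Gadgets S
  stretch≤ : ∀ u v q′ → u ≢ v → Stretch S u v q′ → q′ ℚ.≤ q
  stretch≤ u v q′ _ (a′ , b′ , (_ , a′-min) , _ , b′≢0 , refl)
    with walk≤Φ zero-c₁⊆S u v
  ... | p , p≤Φ =
    /-≤-/1 b′ b {{b′≢0}} {{b≢0}}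
      (≤-trans (a′-min p) (≤-trans p≤Φ (Φ≤len st∉S st-walk)))
      (b-min (step st refl (inj₁ refl) []))
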